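{- Let $n\in\mathbb N$ with $3\mid n$. Then $$\sum_{k=0}^n\binom nk\binom{2k}{k}\frac{u_k(3,3)}{(-4)^k}=0.$$
   Context: For integers $A,B$, the Lucas sequence $u_n=u_n(A,B)$ ($n\in\mathbb N$) is defined by $u_0=0$, $u_1=1$, and $u_{n+1}=Au_n-Bu_{n-1}$ for $n\ge1$. -}

module Defs where

open import Data.Nat using (ℕ; zero; suc)
open import Data.Nat.Combinatorics using (_C_)
open import Data.Integer as ℤ using (ℤ; +_; -[1+_])
open import Data.Rational as ℚ using (ℚ; _/_)

lucasU : ℤ → ℤ → ℕ → ℤ
lucasU A B zero = + 0
lucasU A B (suc zero) = + 1
lucasU A B (suc (suc n)) = A ℤ.* lucasU A B (suc n) ℤ.- B ℤ.* lucasU A B n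

_^ℚ_ : ℚ → ℕ → ℚ
x ^ℚ zero = ℚ.1ℚ
x ^ℚ suc k = x ℚ.* (x ^ℚ k)

sumTo : ℕ → (ℕ → ℚ) → ℚ
sumTo zero f = f 0
sumTo (suc n) f = sumTo n f ℚ.+ f (suc n)

-- 1/(-4) as a rational; x/(-4)^k is written x * (-1/4)^k
minusQuarter : ℚ
minusQuarter = -[1+ 0 ] / 4

term : ℕ → ℕ → ℚ
term n k = ℚ._/_ (+ ((n C k) ℕ.* ((2 ℕ.* k) C k)) ℤ.* lucasU (+ 3) (+ 3) k) 1 ℚ.* (minusQuarter ^ℚ k)
  where import Data.Nat as ℕ

-- Let ω be a root of x² − 3x + 3, the characteristic polynomial of u(3,3), so that
-- ω^k = −3·u_{k−1} + u_k·ω.  With P_n(x) = Σ_k C(n,k)·C(2k,k)·x^k and c = −ω/4, the sum is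
-- the ω-coordinate of P_n(c) in ℚ[ω] = ℚ ⊕ ℚω.  The polynomials P_n satisfy
--   (n+2)·P_{n+2} + (n+1)(1+4x)·P_n = (2n+3)(1+2x)·P_{n+1}.
-- For z′ = ω − 1 one has z′²(1+4c) = 1 and z′(1+2c) = 1/2, so W_n = z′ⁿ·P_n(c) satisfies a
-- recurrence with rational coefficients; since W_0 and W_1 are rational, every W_n is.
-- Finally P_n(c) = zⁿ·W_n for z = 2 − ω = z′⁻¹, and z³ = −1, so P_n(c) is rational when 3 ∣ n.
module Submission where

open import Defs
open import Data.Nat using (ℕ)
open import Data.Nat.Divisibility using (_∣_)
open import Data.Rational using (0ℚ)
open import Relation.Binary.PropositionalEquality using (_≡_)
open import Algebra.Bundles using (CommutativeRing)

module BinomialIdentities where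

  open import Data.Nat
  open import Data.Nat.Properties
  open import Data.Nat.Combinatorics using (_C_; nCk+nC[k+1]≡[n+1]C[k+1]; nCk≡nC[n∸k]; k>n⇒nCk≡0; nC1≡n)
  open import Data.Nat.Tactic.RingSolver using (solve-∀)
  open import Relation.Binary.PropositionalEquality
  open ≡-Reasoning

  pascal : ∀ n k → n C k + n C suc k ≡ suc n C suc k
  pascal = nCk+nC[k+1]≡[n+1]C[k+1]

  absorption : ∀ n k → suc k * (suc n C suc k) ≡ suc n * (n C k)
  absorption n       zero    = trans (+-identityʳ _) (trans (nC1≡n (suc n)) (sym (*-identityʳ (suc n))))
  absorption zero    (suc k) = *-zeroʳ (suc (suc k))
  absorption (suc n) (suc k) = begin
    (2 + k) * ((2 + n) C (2 + k))                   ≡⟨ cong ((2 + k) *_) (sym (pascal (suc n) (suc k))) ⟩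
    (2 + k) * (X + Y)                               ≡⟨ expand k X Y ⟩
    X + (1 + k) * X + (2 + k) * Y                   ≡⟨ cong₂ (λ u v → X + u + v) (absorption n k) (absorption n (suc k)) ⟩
    X + (1 + n) * (n C k) + (1 + n) * (n C (1 + k)) ≡⟨ collect n X (n C k) (n C suc k) ⟩
    X + (1 + n) * (n C k + n C (1 + k))             ≡⟨ cong (λ t → X + (1 + n) * t) (pascal n k) ⟩
    (2 + n) * X                                     ∎
    where
    X = suc n C suc k
    Y = suc n C suc (suc k)
    expand : ∀ k X Y → (2 + k) * (X + Y) ≡ X + (1 + k) * X + (2 + k) * Y
    expand = solve-∀
    collect : ∀ n X a b → X + (1 + n) * a + (1 + n) * b ≡ X + (1 + n) * (a + b)
    collect = solve-∀

  odd-row-symmetry : ∀ j → (1 + 2 * j) C j ≡ (1 + 2 * j) C (1 + j)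
  odd-row-symmetry j = trans (nCk≡nC[n∸k] j≤1+2j) (cong ((1 + 2 * j) C_) 1+2j∸j≡1+j)
    where
    j≤1+2j : j ≤ 1 + 2 * j
    j≤1+2j = ≤-trans (m≤m+n j (j + 0)) (n≤1+n _)
    1+2j∸j≡1+j : (1 + 2 * j) ∸ j ≡ 1 + j
    1+2j∸j≡1+j = trans (cong (_∸ j) (split j)) (m+n∸n≡m (1 + j) j)
      where
      split : ∀ j → 1 + 2 * j ≡ (1 + j) + j
      split = solve-∀

  central-binomial-step : ∀ j → (1 + j) * ((2 * (1 + j)) C (1 + j)) ≡ 2 * (1 + 2 * j) * ((2 * j) C j)
  central-binomial-step j = *-cancelˡ-≡ _ _ (1 + j) (begin
    (1 + j) * ((1 + j) * ((2 * (1 + j)) C (1 + j)))   ≡⟨ cong (λ n → (1 + j) * ((1 + j) * (n C (1 + j)))) (double-suc j) ⟩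
    (1 + j) * ((1 + j) * ((2 + 2 * j) C (1 + j)))     ≡⟨ cong ((1 + j) *_) (absorption (1 + 2 * j) j) ⟩
    (1 + j) * ((2 + 2 * j) * ((1 + 2 * j) C j))       ≡⟨ cong (λ t → (1 + j) * ((2 + 2 * j) * t)) (odd-row-symmetry j) ⟩
    (1 + j) * ((2 + 2 * j) * ((1 + 2 * j) C (1 + j))) ≡⟨ swap (1 + j) (2 + 2 * j) ((1 + 2 * j) C (1 + j)) ⟩
    (2 + 2 * j) * ((1 + j) * ((1 + 2 * j) C (1 + j))) ≡⟨ cong ((2 + 2 * j) *_) (absorption (2 * j) j) ⟩
    (2 + 2 * j) * ((1 + 2 * j) * ((2 * j) C j))       ≡⟨ regroup j ((2 * j) C j) ⟩
    (1 + j) * (2 * (1 + 2 * j) * ((2 * j) C j))       ∎)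
    where
    double-suc : ∀ j → 2 * (1 + j) ≡ 2 + 2 * j
    double-suc = solve-∀
    swap : ∀ a b c → a * (b * c) ≡ b * (a * c)
    swap = solve-∀
    regroup : ∀ j x → (2 + 2 * j) * ((1 + 2 * j) * x) ≡ (1 + j) * (2 * (1 + 2 * j) * x)
    regroup = solve-∀

  binomial-identity : ∀ m j →
    (1 + 2 * j) * ((2 + m) * ((2 + m) C (1 + j)) + (1 + m) * (m C (1 + j))) + (1 + j) * (2 * (1 + m) * (m C j))
    ≡ (1 + 2 * j) * ((3 + 2 * m) * ((1 + m) C (1 + j))) + (1 + j) * ((3 + 2 * m) * ((1 + m) C j))
  binomial-identity m j =
    from-relations (m C j) (m C (1 + j)) ((1 + m) C j) _ _
      (sym (pascal m j)) (sym (pascal (1 + m) j)) (absorption m j) (absorption (1 + m) j)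
    where
    -- Only Pascal's rule (twice) and absorption (twice) are needed: after adding
    -- (m+2)·Y0 + (j+1)·(X0+X1) to both sides the claim becomes a polynomial identity.
    polynomial : ∀ m j X0 X1 Y0 →
      (1 + 2 * j) * ((2 + m) * (Y0 + (X0 + X1)) + (1 + m) * X1) + (1 + j) * (2 * (1 + m) * X0)
        + ((2 + m) * Y0 + (1 + j) * (X0 + X1))
      ≡ (1 + 2 * j) * ((3 + 2 * m) * (X0 + X1)) + (1 + j) * ((3 + 2 * m) * Y0)
        + ((1 + j) * (Y0 + (X0 + X1)) + (1 + m) * X0)
    polynomial = solve-∀
    from-relations : ∀ X0 X1 Y0 Y1 Z1 → Y1 ≡ X0 + X1 → Z1 ≡ Y0 + Y1 →
      (1 + j) * Y1 ≡ (1 + m) * X0 → (1 + j) * Z1 ≡ (2 + m) * Y0 →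
      (1 + 2 * j) * ((2 + m) * Z1 + (1 + m) * X1) + (1 + j) * (2 * (1 + m) * X0)
      ≡ (1 + 2 * j) * ((3 + 2 * m) * Y1) + (1 + j) * ((3 + 2 * m) * Y0)
    from-relations X0 X1 Y0 _ _ refl refl absorb₀ absorb₁ =
      +-cancelʳ-≡ _ _ _ (trans (polynomial m j X0 X1 Y0) (cong (rhs +_) (cong₂ _+_ absorb₁ (sym absorb₀))))
      where
      rhs = (1 + 2 * j) * ((3 + 2 * m) * (X0 + X1)) + (1 + j) * ((3 + 2 * m) * Y0)

  coeff : ℕ → ℕ → ℕ
  coeff n k = (n C k) * ((2 * k) C k)

  -- Coefficients of x·f(x) when f is given by its coefficient sequence.
  shift : (ℕ → ℕ) → ℕ → ℕ
  shift f zero    = 0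
  shift f (suc k) = f k

  coeff-vanishes : ∀ n k → n < k → coeff n k ≡ 0
  coeff-vanishes n k n<k = cong (_* ((2 * k) C k)) (k>n⇒nCk≡0 n<k)

  -- Multiplying by (j+1) clears the central binomial coefficient C(2j+2, j+1).
  clear-central : ∀ j α β →
    (1 + j) * (α * ((2 * (1 + j)) C (1 + j)) + 2 * (β * ((2 * j) C j)))
    ≡ 2 * ((2 * j) C j) * ((1 + 2 * j) * α + (1 + j) * β)
  clear-central j α β = begin
    (1 + j) * (α * P′ + 2 * (β * P))        ≡⟨ distribute j α β P P′ ⟩
    α * ((1 + j) * P′) + 2 * (1 + j) * (β * P) ≡⟨ cong (λ t → α * t + 2 * (1 + j) * (β * P)) (central-binomial-step j) ⟩
    α * (2 * (1 + 2 * j) * P) + 2 * (1 + j) * (β * P) ≡⟨ factor j α β P ⟩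
    2 * P * ((1 + 2 * j) * α + (1 + j) * β) ∎
    where
    P = (2 * j) C j
    P′ = (2 * (1 + j)) C (1 + j)
    distribute : ∀ j α β P P′ → (1 + j) * (α * P′ + 2 * (β * P)) ≡ α * ((1 + j) * P′) + 2 * (1 + j) * (β * P)
    distribute = solve-∀
    factor : ∀ j α β P → α * (2 * (1 + 2 * j) * P) + 2 * (1 + j) * (β * P) ≡ 2 * P * ((1 + 2 * j) * α + (1 + j) * β)
    factor = solve-∀

  -- The coefficient form of  (m+2) P_{m+2} + (m+1)(1+4x) P_m = (2m+3)(1+2x) P_{m+1}.
  coeff-recurrence : ∀ m k →
    (2 + m) * coeff (2 + m) k + (1 + m) * (coeff m k + 4 * shift (coeff m) k)
    ≡ (3 + 2 * m) * (coeff (1 + m) k + 2 * shift (coeff (1 + m)) k)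
  coeff-recurrence m zero    = constant-terms m
    where
    constant-terms : ∀ m → (2 + m) * (1 * 1) + (1 + m) * (1 * 1 + 4 * 0) ≡ (3 + 2 * m) * (1 * 1 + 2 * 0)
    constant-terms = solve-∀
  coeff-recurrence m (suc j) = *-cancelˡ-≡ _ _ (1 + j) (begin
    (1 + j) * ((2 + m) * (Z1 * P′) + (1 + m) * (X1 * P′ + 4 * (X0 * P)))
      ≡⟨ cong ((1 + j) *_) (split-left m Z1 X1 X0 P P′) ⟩
    (1 + j) * (((2 + m) * Z1 + (1 + m) * X1) * P′ + 2 * (2 * (1 + m) * X0 * P))
      ≡⟨ clear-central j ((2 + m) * Z1 + (1 + m) * X1) (2 * (1 + m) * X0) ⟩
    2 * P * ((1 + 2 * j) * ((2 + m) * Z1 + (1 + m) * X1) + (1 + j) * (2 * (1 + m) * X0))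
      ≡⟨ cong (2 * P *_) (binomial-identity m j) ⟩
    2 * P * ((1 + 2 * j) * ((3 + 2 * m) * Y1) + (1 + j) * ((3 + 2 * m) * Y0))
      ≡⟨ clear-central j ((3 + 2 * m) * Y1) ((3 + 2 * m) * Y0) ⟨
    (1 + j) * ((3 + 2 * m) * Y1 * P′ + 2 * ((3 + 2 * m) * Y0 * P))
      ≡⟨ cong ((1 + j) *_) (split-right m Y1 Y0 P P′) ⟨
    (1 + j) * ((3 + 2 * m) * (Y1 * P′ + 2 * (Y0 * P))) ∎)
    where
    X0 = m C j
    X1 = m C (1 + j)
    Y0 = (1 + m) C j
    Y1 = (1 + m) C (1 + j)
    Z1 = (2 + m) C (1 + j)
    P = (2 * j) C j
    P′ = (2 * (1 + j)) C (1 + j)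
    split-left : ∀ m Z1 X1 X0 P P′ →
      (2 + m) * (Z1 * P′) + (1 + m) * (X1 * P′ + 4 * (X0 * P))
      ≡ ((2 + m) * Z1 + (1 + m) * X1) * P′ + 2 * (2 * (1 + m) * X0 * P)
    split-left = solve-∀
    split-right : ∀ m Y1 Y0 P P′ →
      (3 + 2 * m) * (Y1 * P′ + 2 * (Y0 * P)) ≡ (3 + 2 * m) * Y1 * P′ + 2 * ((3 + 2 * m) * Y0 * P)
    split-right = solve-∀

module PolynomialRecurrence {c ℓ} (R : CommutativeRing c ℓ) where
  open import Data.Nat as ℕ using (zero; suc; _≤_; z≤n)
  import Data.Nat.Properties as ℕₚ
  import Relation.Binary.PropositionalEquality as ≡
  open BinomialIdentities using (coeff; shift; coeff-vanishes; coeff-recurrence)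

  open CommutativeRing R
  open import Algebra.Properties.Semiring.Mult semiring using (_×_; ×-homo-+; ×1-homo-*)
  open import Algebra.Properties.Semiring.Exp semiring using (_^_)
  open import Algebra.Solver.Ring.NaturalCoefficients.Default commutativeSemiring
    using (solve; _:+_; _:*_; _:=_; con)
  open import Relation.Binary.Reasoning.Setoid setoid

  ⟦_⟧ : ℕ → Carrier
  ⟦ n ⟧ = n × 1#

  ⟦⟧-+ : ∀ m n → ⟦ m ℕ.+ n ⟧ ≈ ⟦ m ⟧ + ⟦ n ⟧
  ⟦⟧-+ = ×-homo-+ 1#

  sum : ℕ → (ℕ → Carrier) → Carrier
  sum zero    f = f 0
  sum (suc d) f = sum d f + f (suc d)

  sum-cong : ∀ d {f g} → (∀ k → k ≤ d → f k ≈ g k) → sum d f ≈ sum d g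
  sum-cong zero    f≈g = f≈g 0 z≤n
  sum-cong (suc d) f≈g = +-cong (sum-cong d (λ k k≤d → f≈g k (ℕₚ.m≤n⇒m≤1+n k≤d))) (f≈g (suc d) ℕₚ.≤-refl)

  sum-+ : ∀ d f g → sum d (λ k → f k + g k) ≈ sum d f + sum d g
  sum-+ zero    f g = refl
  sum-+ (suc d) f g = trans (+-congʳ (sum-+ d f g))
    (solve 4 (λ a b c d → (a :+ b) :+ (c :+ d) := (a :+ c) :+ (b :+ d)) refl
           (sum d f) (sum d g) (f (suc d)) (g (suc d)))

  sum-*ˡ : ∀ d x f → x * sum d f ≈ sum d (λ k → x * f k)
  sum-*ˡ zero    x f = refl
  sum-*ˡ (suc d) x f = trans (distribˡ _ _ _) (+-congʳ (sum-*ˡ d x f))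

  sum-split : ∀ d f → sum (suc d) f ≈ f 0 + sum d (λ k → f (suc k))
  sum-split zero    f = refl
  sum-split (suc d) f = trans (+-congʳ (sum-split d f)) (+-assoc _ _ _)

  eval : ℕ → (ℕ → ℕ) → Carrier → Carrier
  eval d f x = sum d (λ k → ⟦ f k ⟧ * x ^ k)

  module _ (x : Carrier) where

    eval-cong : ∀ d {f g} → (∀ k → f k ≡ g k) → eval d f x ≈ eval d g x
    eval-cong d f≡g = sum-cong d (λ k _ → reflexive (≡.cong (λ n → ⟦ n ⟧ * x ^ k) (f≡g k)))

    eval-+ : ∀ d f g → eval d (λ k → f k ℕ.+ g k) x ≈ eval d f x + eval d g x
    eval-+ d f g = trans (sum-cong d (λ k _ → trans (*-congʳ (⟦⟧-+ (f k) (g k))) (distribʳ _ _ _)))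
                         (sum-+ d _ _)

    eval-scale : ∀ d m f → eval d (λ k → m ℕ.* f k) x ≈ ⟦ m ⟧ * eval d f x
    eval-scale d m f = trans (sum-cong d (λ k _ → trans (*-congʳ (×1-homo-* m (f k))) (*-assoc _ _ _)))
                             (sym (sum-*ˡ d _ _))

    eval-extend : ∀ d f → f (suc d) ≡ 0 → eval (suc d) f x ≈ eval d f x
    eval-extend d f f[1+d]≡0 = begin
      eval d f x + ⟦ f (suc d) ⟧ * x ^ suc d ≡⟨ ≡.cong (λ n → eval d f x + ⟦ n ⟧ * x ^ suc d) f[1+d]≡0 ⟩
      eval d f x + 0# * x ^ suc d           ≈⟨ +-congˡ (zeroˡ _) ⟩
      eval d f x + 0#                       ≈⟨ +-identityʳ _ ⟩
      eval d f x                            ∎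

    eval-shift : ∀ d f → eval (suc d) (shift f) x ≈ x * eval d f x
    eval-shift d f = begin
      eval (suc d) (shift f) x                                ≈⟨ sum-split d _ ⟩
      ⟦ 0 ⟧ * 1# + sum d (λ k → ⟦ f k ⟧ * (x * x ^ k))         ≈⟨ +-cong (zeroˡ _) (sum-cong d (λ k _ → rearrange (⟦ f k ⟧) (x ^ k))) ⟩
      0# + sum d (λ k → x * (⟦ f k ⟧ * x ^ k))                 ≈⟨ +-identityˡ _ ⟩
      sum d (λ k → x * (⟦ f k ⟧ * x ^ k))                      ≈⟨ sum-*ˡ d x _ ⟨
      x * eval d f x                                          ∎
      where
      rearrange : ∀ a p → a * (x * p) ≈ x * (a * p)
      rearrange a p = solve 3 (λ a x p → a :* (x :* p) := x :* (a :* p)) refl a x p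

    eval-mul : ∀ d f c → f (suc d) ≡ 0 →
      eval (suc d) (λ k → f k ℕ.+ c ℕ.* shift f k) x ≈ (1# + ⟦ c ⟧ * x) * eval d f x
    eval-mul d f c f[1+d]≡0 = begin
      eval (suc d) (λ k → f k ℕ.+ c ℕ.* shift f k) x           ≈⟨ eval-+ (suc d) f _ ⟩
      eval (suc d) f x + eval (suc d) (λ k → c ℕ.* shift f k) x ≈⟨ +-cong (eval-extend d f f[1+d]≡0) (eval-scale (suc d) c (shift f)) ⟩
      eval d f x + ⟦ c ⟧ * eval (suc d) (shift f) x            ≈⟨ +-congˡ (*-congˡ (eval-shift d f)) ⟩
      eval d f x + ⟦ c ⟧ * (x * eval d f x)                    ≈⟨ solve 3 (λ e c x → e :+ c :* (x :* e) := (con 1 :+ c :* x) :* e) refl (eval d f x) ⟦ c ⟧ x ⟩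
      (1# + ⟦ c ⟧ * x) * eval d f x                            ∎

  P : ℕ → Carrier → Carrier
  P n x = eval n (coeff n) x

  P-recurrence : ∀ m x →
    ⟦ 2 ℕ.+ m ⟧ * P (2 ℕ.+ m) x + ⟦ 1 ℕ.+ m ⟧ * ((1# + ⟦ 4 ⟧ * x) * P m x)
    ≈ ⟦ 3 ℕ.+ 2 ℕ.* m ⟧ * ((1# + ⟦ 2 ⟧ * x) * P (1 ℕ.+ m) x)
  P-recurrence m x = begin
    ⟦ 2 ℕ.+ m ⟧ * P (2 ℕ.+ m) x + ⟦ 1 ℕ.+ m ⟧ * ((1# + ⟦ 4 ⟧ * x) * P m x)
      ≈⟨ +-congˡ (*-congˡ times-1+4x) ⟨
    ⟦ 2 ℕ.+ m ⟧ * P (2 ℕ.+ m) x + ⟦ 1 ℕ.+ m ⟧ * eval (2 ℕ.+ m) left x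
      ≈⟨ +-cong (eval-scale x (2 ℕ.+ m) (2 ℕ.+ m) (coeff (2 ℕ.+ m))) (eval-scale x (2 ℕ.+ m) (1 ℕ.+ m) left) ⟨
    eval (2 ℕ.+ m) (λ k → (2 ℕ.+ m) ℕ.* coeff (2 ℕ.+ m) k) x + eval (2 ℕ.+ m) (λ k → (1 ℕ.+ m) ℕ.* left k) x
      ≈⟨ eval-+ x (2 ℕ.+ m) (λ k → (2 ℕ.+ m) ℕ.* coeff (2 ℕ.+ m) k) (λ k → (1 ℕ.+ m) ℕ.* left k) ⟨
    eval (2 ℕ.+ m) (λ k → (2 ℕ.+ m) ℕ.* coeff (2 ℕ.+ m) k ℕ.+ (1 ℕ.+ m) ℕ.* left k) x
      ≈⟨ eval-cong x (2 ℕ.+ m) (coeff-recurrence m) ⟩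
    eval (2 ℕ.+ m) (λ k → (3 ℕ.+ 2 ℕ.* m) ℕ.* right k) x
      ≈⟨ eval-scale x (2 ℕ.+ m) (3 ℕ.+ 2 ℕ.* m) right ⟩
    ⟦ 3 ℕ.+ 2 ℕ.* m ⟧ * eval (2 ℕ.+ m) right x
      ≈⟨ *-congˡ (eval-mul x (1 ℕ.+ m) (coeff (1 ℕ.+ m)) 2 (coeff-vanishes (1 ℕ.+ m) (2 ℕ.+ m) ℕₚ.≤-refl)) ⟩
    ⟦ 3 ℕ.+ 2 ℕ.* m ⟧ * ((1# + ⟦ 2 ⟧ * x) * P (1 ℕ.+ m) x) ∎
    where
    left right : ℕ → ℕ
    left k = coeff m k ℕ.+ 4 ℕ.* shift (coeff m) k
    right k = coeff (1 ℕ.+ m) k ℕ.+ 2 ℕ.* shift (coeff (1 ℕ.+ m)) k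
    times-1+4x : eval (2 ℕ.+ m) left x ≈ (1# + ⟦ 4 ⟧ * x) * P m x
    times-1+4x = trans (eval-mul x (1 ℕ.+ m) (coeff m) 4 (coeff-vanishes m (2 ℕ.+ m) (ℕₚ.m≤n⇒m≤1+n ℕₚ.≤-refl)))
                       (*-congˡ (eval-extend x m (coeff m) (coeff-vanishes m (1 ℕ.+ m) ℕₚ.≤-refl)))

  twisted-recurrence : ∀ {x z h} → z * (z * (1# + ⟦ 4 ⟧ * x)) ≈ 1# → z * (1# + ⟦ 2 ⟧ * x) ≈ h → ∀ m →
    ⟦ 2 ℕ.+ m ⟧ * (z ^ (2 ℕ.+ m) * P (2 ℕ.+ m) x) + ⟦ 1 ℕ.+ m ⟧ * (z ^ m * P m x)
    ≈ ⟦ 3 ℕ.+ 2 ℕ.* m ⟧ * (h * (z ^ (1 ℕ.+ m) * P (1 ℕ.+ m) x))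
  twisted-recurrence {x} {z} {h} z²[1+4x]≈1 z[1+2x]≈h m = begin
    A * (z * (z * zᵐ) * P₂) + B * (zᵐ * P₀)
      ≈⟨ +-congˡ (*-congˡ (trans (*-congʳ z²[1+4x]≈1) (*-identityˡ _))) ⟨
    A * (z * (z * zᵐ) * P₂) + B * (z * (z * q) * (zᵐ * P₀))
      ≈⟨ solve 7 (λ A B z zᵐ q P₀ P₂ → A :* (z :* (z :* zᵐ) :* P₂) :+ B :* (z :* (z :* q) :* (zᵐ :* P₀))
                                       := z :* (z :* zᵐ) :* (A :* P₂ :+ B :* (q :* P₀))) refl A B z zᵐ q P₀ P₂ ⟩
    z * (z * zᵐ) * (A * P₂ + B * (q * P₀))
      ≈⟨ *-congˡ (P-recurrence m x) ⟩
    z * (z * zᵐ) * (C * (r * P₁))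
      ≈⟨ solve 5 (λ C z zᵐ r P₁ → z :* (z :* zᵐ) :* (C :* (r :* P₁)) := C :* ((z :* r) :* (z :* zᵐ :* P₁))) refl C z zᵐ r P₁ ⟩
    C * ((z * r) * (z * zᵐ * P₁))
      ≈⟨ *-congˡ (*-congʳ z[1+2x]≈h) ⟩
    C * (h * (z * zᵐ * P₁)) ∎
    where
    A = ⟦ 2 ℕ.+ m ⟧
    B = ⟦ 1 ℕ.+ m ⟧
    C = ⟦ 3 ℕ.+ 2 ℕ.* m ⟧
    q = 1# + ⟦ 4 ⟧ * x
    r = 1# + ⟦ 2 ⟧ * x
    zᵐ = z ^ m
    P₀ = P m x
    P₁ = P (1 ℕ.+ m) x
    P₂ = P (2 ℕ.+ m) x

  inverse-powers : ∀ {z z′} → z * z′ ≈ 1# → ∀ n y → z ^ n * (z′ ^ n * y) ≈ y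
  inverse-powers zz′≈1 zero    y = trans (*-identityˡ _) (*-identityˡ y)
  inverse-powers {z} {z′} zz′≈1 (suc n) y = begin
    z * z ^ n * (z′ * z′ ^ n * y)       ≈⟨ solve 5 (λ z z′ a b y → z :* a :* (z′ :* b :* y) := z :* z′ :* (a :* (b :* y))) refl z z′ (z ^ n) (z′ ^ n) y ⟩
    z * z′ * (z ^ n * (z′ ^ n * y))     ≈⟨ *-cong zz′≈1 (inverse-powers zz′≈1 n y) ⟩
    1# * y                             ≈⟨ *-identityˡ y ⟩
    y                                  ∎

open import Level using (0ℓ)
open import Data.Nat as ℕ using (zero; suc)
open import Data.Nat.Divisibility using (divides)
open import Data.Integer as ℤ using (ℤ; +_)
import Data.Integer.Properties as ℤₚ
import Data.Integer.Tactic.RingSolver as ℤ-Solver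
open import Data.Rational as ℚ using (ℚ; 1ℚ; ½; _+_; _*_; _-_; -_)
import Data.Rational.Properties as ℚₚ
open import Data.Rational.Unnormalised as ℚᵘ using (mkℚᵘ; _≃_; *≡*)
import Data.Rational.Unnormalised.Properties as ℚᵘₚ
open import Data.Product using (∃; _×_; _,_; proj₁; proj₂)
open import Data.List using (_∷_; [])
open import Relation.Nullary.Decidable using (dec⇒maybe)
open import Algebra.Structures using (IsCommutativeRing)
open import Relation.Binary.PropositionalEquality
open import Tactic.RingSolver using (solve; solve-∀)
import Tactic.RingSolver.Core.AlmostCommutativeRing as ACR

-- The rationals as a ring for the reflective ring solver (with a decision procedure for
-- zero, so that numeral coefficients normalise).
ℚ-ring : ACR.AlmostCommutativeRing 0ℓ 0ℓ
ℚ-ring = ACR.fromCommutativeRing ℚₚ.+-*-commutativeRing (λ x → dec⇒maybe (0ℚ ℚ.≟ x))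

ι : ℤ → ℚ
ι x = x ℚ./ 1

-- ι x is, by definition, the normalisation of the unnormalised rational x/1;
-- identities for ι are therefore checked on unnormalised representatives.
toℚᵘ-ι : ∀ x → ℚ.toℚᵘ (ι x) ≃ mkℚᵘ x 0
toℚᵘ-ι x = ℚₚ.toℚᵘ-fromℚᵘ (mkℚᵘ x 0)

ι-+ : ∀ x y → ι (x ℤ.+ y) ≡ ι x + ι y
ι-+ x y = ℚₚ.toℚᵘ-injective (begin
  ℚ.toℚᵘ (ι (x ℤ.+ y))                ≈⟨ toℚᵘ-ι (x ℤ.+ y) ⟩
  mkℚᵘ (x ℤ.+ y) 0                    ≈⟨ *≡* (unit-denominators x y) ⟩
  mkℚᵘ x 0 ℚᵘ.+ mkℚᵘ y 0              ≈⟨ ℚᵘₚ.+-cong (toℚᵘ-ι x) (toℚᵘ-ι y) ⟨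
  ℚ.toℚᵘ (ι x) ℚᵘ.+ ℚ.toℚᵘ (ι y)      ≈⟨ ℚₚ.toℚᵘ-homo-+ (ι x) (ι y) ⟨
  ℚ.toℚᵘ (ι x + ι y)                  ∎)
  where
  open ℚᵘₚ.≃-Reasoning
  unit-denominators : ∀ x y → (x ℤ.+ y) ℤ.* + 1 ≡ (x ℤ.* + 1 ℤ.+ y ℤ.* + 1) ℤ.* + 1
  unit-denominators = ℤ-Solver.solve-∀

ι-* : ∀ x y → ι (x ℤ.* y) ≡ ι x * ι y
ι-* x y = ℚₚ.toℚᵘ-injective (begin
  ℚ.toℚᵘ (ι (x ℤ.* y))                ≈⟨ toℚᵘ-ι (x ℤ.* y) ⟩
  mkℚᵘ x 0 ℚᵘ.* mkℚᵘ y 0              ≈⟨ ℚᵘₚ.*-cong (toℚᵘ-ι x) (toℚᵘ-ι y) ⟨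
  ℚ.toℚᵘ (ι x) ℚᵘ.* ℚ.toℚᵘ (ι y)      ≈⟨ ℚₚ.toℚᵘ-homo-* (ι x) (ι y) ⟨
  ℚ.toℚᵘ (ι x * ι y)                  ∎)
  where open ℚᵘₚ.≃-Reasoning

ι-neg : ∀ x → ι (ℤ.- x) ≡ - ι x
ι-neg x = ℚₚ.toℚᵘ-injective (begin
  ℚ.toℚᵘ (ι (ℤ.- x))                  ≈⟨ toℚᵘ-ι (ℤ.- x) ⟩
  ℚᵘ.- mkℚᵘ x 0                       ≈⟨ ℚᵘₚ.-‿cong (toℚᵘ-ι x) ⟨
  ℚᵘ.- ℚ.toℚᵘ (ι x)                   ≈⟨ ℚₚ.toℚᵘ-homo‿- (ι x) ⟨
  ℚ.toℚᵘ (- ι x)                      ∎)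
  where open ℚᵘₚ.≃-Reasoning

ι-injective : ∀ {x y} → ι x ≡ ι y → x ≡ y
ι-injective {x} {y} ιx≡ιy with ℚᵘₚ.≃-trans (ℚᵘₚ.≃-sym (toℚᵘ-ι x)) (ℚᵘₚ.≃-trans (ℚₚ.toℚᵘ-cong ιx≡ιy) (toℚᵘ-ι y))
... | *≡* x*1≡y*1 = trans (sym (ℤₚ.*-identityʳ x)) (trans x*1≡y*1 (ℤₚ.*-identityʳ y))

cancel-nonzero : ∀ c y → c ≢ 0ℚ → c * y ≡ 0ℚ → y ≡ 0ℚ
cancel-nonzero c y c≢0 cy≡0 = begin
  y                  ≡⟨ ℚₚ.*-identityˡ y ⟨
  1ℚ * y             ≡⟨ cong (_* y) (ℚₚ.*-inverseˡ c) ⟨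
  ℚ.1/ c * c * y     ≡⟨ ℚₚ.*-assoc (ℚ.1/ c) c y ⟩
  ℚ.1/ c * (c * y)   ≡⟨ cong (ℚ.1/ c *_) cy≡0 ⟩
  ℚ.1/ c * 0ℚ        ≡⟨ ℚₚ.*-zeroʳ (ℚ.1/ c) ⟩
  0ℚ                 ∎
  where
  open ≡-Reasoning
  instance _ = ℚ.≢-nonZero c≢0

-- The ring ℚ[ω] with ω² = A·ω − B; ⟨ a , b ⟩ represents a + b·ω.
module QuadraticExtension (A B : ℚ) where

  data Qω : Set where
    ⟨_,_⟩ : ℚ → ℚ → Qω

  infixl 6 _⊕_
  infixl 7 _⊛_

  _⊕_ : Qω → Qω → Qω
  ⟨ a , b ⟩ ⊕ ⟨ c , d ⟩ = ⟨ a + c , b + d ⟩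

  -- (a + bω)(c + dω) = ac + (ad + bc)ω + bd(Aω − B)
  _⊛_ : Qω → Qω → Qω
  ⟨ a , b ⟩ ⊛ ⟨ c , d ⟩ = ⟨ a * c - B * (b * d) , a * d + b * c + A * (b * d) ⟩

  ⊖_ : Qω → Qω
  ⊖ ⟨ a , b ⟩ = ⟨ - a , - b ⟩

  0ω 1ω : Qω
  0ω = ⟨ 0ℚ , 0ℚ ⟩
  1ω = ⟨ 1ℚ , 0ℚ ⟩

  scalar : ℚ → Qω
  scalar r = ⟨ r , 0ℚ ⟩

  ω-part : Qω → ℚ
  ω-part ⟨ _ , b ⟩ = b

  ω-part-⊕ : ∀ x y → ω-part (x ⊕ y) ≡ ω-part x + ω-part y
  ω-part-⊕ ⟨ _ , _ ⟩ ⟨ _ , _ ⟩ = refl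

  pair : ∀ {a b c d : ℚ} → a ≡ c → b ≡ d → ⟨ a , b ⟩ ≡ ⟨ c , d ⟩
  pair = cong₂ ⟨_,_⟩

  ⊕-assoc : ∀ x y z → (x ⊕ y) ⊕ z ≡ x ⊕ (y ⊕ z)
  ⊕-assoc ⟨ a , b ⟩ ⟨ c , d ⟩ ⟨ e , f ⟩ = pair (ℚₚ.+-assoc a c e) (ℚₚ.+-assoc b d f)

  ⊕-comm : ∀ x y → x ⊕ y ≡ y ⊕ x
  ⊕-comm ⟨ a , b ⟩ ⟨ c , d ⟩ = pair (ℚₚ.+-comm a c) (ℚₚ.+-comm b d)

  ⊕-identityˡ : ∀ x → 0ω ⊕ x ≡ x
  ⊕-identityˡ ⟨ a , b ⟩ = pair (ℚₚ.+-identityˡ a) (ℚₚ.+-identityˡ b)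

  ⊕-identityʳ : ∀ x → x ⊕ 0ω ≡ x
  ⊕-identityʳ ⟨ a , b ⟩ = pair (ℚₚ.+-identityʳ a) (ℚₚ.+-identityʳ b)

  ⊖-inverseˡ : ∀ x → ⊖ x ⊕ x ≡ 0ω
  ⊖-inverseˡ ⟨ a , b ⟩ = pair (ℚₚ.+-inverseˡ a) (ℚₚ.+-inverseˡ b)

  ⊖-inverseʳ : ∀ x → x ⊕ ⊖ x ≡ 0ω
  ⊖-inverseʳ ⟨ a , b ⟩ = pair (ℚₚ.+-inverseʳ a) (ℚₚ.+-inverseʳ b)

  ⊛-comm : ∀ x y → x ⊛ y ≡ y ⊛ x
  ⊛-comm ⟨ a , b ⟩ ⟨ c , d ⟩ = pair
    (solve (a ∷ b ∷ c ∷ d ∷ B ∷ []) ℚ-ring)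
    (solve (a ∷ b ∷ c ∷ d ∷ A ∷ []) ℚ-ring)

  ⊛-assoc : ∀ x y z → (x ⊛ y) ⊛ z ≡ x ⊛ (y ⊛ z)
  ⊛-assoc ⟨ a , b ⟩ ⟨ c , d ⟩ ⟨ e , f ⟩ = pair
    (solve (a ∷ b ∷ c ∷ d ∷ e ∷ f ∷ A ∷ B ∷ []) ℚ-ring)
    (solve (a ∷ b ∷ c ∷ d ∷ e ∷ f ∷ A ∷ B ∷ []) ℚ-ring)

  ⊛-identityˡ : ∀ x → 1ω ⊛ x ≡ x
  ⊛-identityˡ ⟨ c , d ⟩ = pair (solve (c ∷ d ∷ B ∷ []) ℚ-ring) (solve (c ∷ d ∷ A ∷ []) ℚ-ring)

  ⊛-identityʳ : ∀ x → x ⊛ 1ω ≡ x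
  ⊛-identityʳ x = trans (⊛-comm x 1ω) (⊛-identityˡ x)

  ⊛-distribˡ : ∀ x y z → x ⊛ (y ⊕ z) ≡ x ⊛ y ⊕ x ⊛ z
  ⊛-distribˡ ⟨ a , b ⟩ ⟨ c , d ⟩ ⟨ e , f ⟩ = pair
    (solve (a ∷ b ∷ c ∷ d ∷ e ∷ f ∷ B ∷ []) ℚ-ring)
    (solve (a ∷ b ∷ c ∷ d ∷ e ∷ f ∷ A ∷ []) ℚ-ring)

  ⊛-distribʳ : ∀ x y z → (y ⊕ z) ⊛ x ≡ y ⊛ x ⊕ z ⊛ x
  ⊛-distribʳ x y z = trans (⊛-comm (y ⊕ z) x) (trans (⊛-distribˡ x y z) (cong₂ _⊕_ (⊛-comm x y) (⊛-comm x z)))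

  ℚ[ω] : CommutativeRing 0ℓ 0ℓ
  ℚ[ω] = record { isCommutativeRing = isCommutativeRing }
    where
    isCommutativeRing : IsCommutativeRing _≡_ _⊕_ _⊛_ ⊖_ 0ω 1ω
    isCommutativeRing = record
      { isRing = record
        { +-isAbelianGroup = record
          { isGroup = record
            { isMonoid = record
              { isSemigroup = record
                { isMagma = record { isEquivalence = isEquivalence ; ∙-cong = cong₂ _⊕_ }
                ; assoc = ⊕-assoc }
              ; identity = ⊕-identityˡ , ⊕-identityʳ }
            ; inverse = ⊖-inverseˡ , ⊖-inverseʳ
            ; ⁻¹-cong = cong ⊖_ }
          ; comm = ⊕-comm }
        ; *-cong = cong₂ _⊛_
        ; *-assoc = ⊛-assoc
        ; *-identity = ⊛-identityˡ , ⊛-identityʳ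
        ; distrib = ⊛-distribˡ , ⊛-distribʳ }
      ; *-comm = ⊛-comm }

  ω-part-scalar : ∀ r x → ω-part (scalar r ⊛ x) ≡ r * ω-part x
  ω-part-scalar r ⟨ c , d ⟩ = expanded
    where
    expanded : r * d + 0ℚ * c + A * (0ℚ * d) ≡ r * d
    expanded = solve (r ∷ c ∷ d ∷ A ∷ []) ℚ-ring

  scalar-⊛ : ∀ r s → scalar r ⊛ scalar s ≡ scalar (r * s)
  scalar-⊛ r s = pair (solve (r ∷ s ∷ B ∷ []) ℚ-ring) (solve (r ∷ s ∷ A ∷ []) ℚ-ring)

module LucasPowers (a b : ℤ) where
  open QuadraticExtension (ι a) (ι b)
  open import Algebra.Properties.Semiring.Exp (CommutativeRing.semiring ℚ[ω]) using (_^_)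

  u : ℕ → ℤ
  u = lucasU a b

  ι-lucas : ∀ k → ι (u (2 ℕ.+ k)) ≡ ι a * ι (u (1 ℕ.+ k)) - ι b * ι (u k)
  ι-lucas k = begin
    ι (a ℤ.* u (1 ℕ.+ k) ℤ.+ ℤ.- (b ℤ.* u k))   ≡⟨ ι-+ (a ℤ.* u (1 ℕ.+ k)) (ℤ.- (b ℤ.* u k)) ⟩
    ι (a ℤ.* u (1 ℕ.+ k)) + ι (ℤ.- (b ℤ.* u k)) ≡⟨ cong₂ _+_ (ι-* a (u (1 ℕ.+ k))) (trans (ι-neg (b ℤ.* u k)) (cong -_ (ι-* b (u k)))) ⟩
    ι a * ι (u (1 ℕ.+ k)) - ι b * ι (u k)       ∎
    where open ≡-Reasoning

  power-of-ω-multiple : ∀ r k →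
    ⟨ 0ℚ , r ⟩ ^ suc k ≡ ⟨ - (ι b * (ι (u k) * r ^ℚ suc k)) , ι (u (suc k)) * r ^ℚ suc k ⟩
  power-of-ω-multiple r zero = pair (rational-part r (ι b)) (ω-coordinate r (ι a))
    where
    rational-part : ∀ r B → 0ℚ * 1ℚ - B * (r * 0ℚ) ≡ - (B * (0ℚ * (r * 1ℚ)))
    rational-part = solve-∀ ℚ-ring
    ω-coordinate : ∀ r A → 0ℚ * 0ℚ + r * 1ℚ + A * (r * 0ℚ) ≡ 1ℚ * (r * 1ℚ)
    ω-coordinate = solve-∀ ℚ-ring
  power-of-ω-multiple r (suc k) = begin
    ⟨ 0ℚ , r ⟩ ⊛ ⟨ 0ℚ , r ⟩ ^ suc k              ≡⟨ cong (⟨ 0ℚ , r ⟩ ⊛_) (power-of-ω-multiple r k) ⟩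
    ⟨ 0ℚ , r ⟩ ⊛ ⟨ - (ι b * (u₀ * p)) , u₁ * p ⟩ ≡⟨ pair (rational-part r (ι b) u₀ u₁ p) ω-coordinate′ ⟩
    ⟨ - (ι b * (u₁ * (r * p))) , ι (u (2 ℕ.+ k)) * (r * p) ⟩ ∎
    where
    open ≡-Reasoning
    u₀ = ι (u k)
    u₁ = ι (u (1 ℕ.+ k))
    p = r ^ℚ suc k
    rational-part : ∀ r B u₀ u₁ p → 0ℚ * - (B * (u₀ * p)) - B * (r * (u₁ * p)) ≡ - (B * (u₁ * (r * p)))
    rational-part = solve-∀ ℚ-ring
    ω-coordinate : ∀ r A B u₀ u₁ p →
      0ℚ * (u₁ * p) + r * - (B * (u₀ * p)) + A * (r * (u₁ * p)) ≡ (A * u₁ - B * u₀) * (r * p)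
    ω-coordinate = solve-∀ ℚ-ring
    ω-coordinate′ : 0ℚ * (u₁ * p) + r * - (ι b * (u₀ * p)) + ι a * (r * (u₁ * p)) ≡ ι (u (2 ℕ.+ k)) * (r * p)
    ω-coordinate′ = trans (ω-coordinate r (ι a) (ι b) u₀ u₁ p) (cong (_* (r * p)) (sym (ι-lucas k)))

  ω-part-power : ∀ r k → ω-part (⟨ 0ℚ , r ⟩ ^ k) ≡ ι (u k) * r ^ℚ k
  ω-part-power r zero    = refl
  ω-part-power r (suc k) = cong ω-part (power-of-ω-multiple r k)

open BinomialIdentities using (coeff)
open QuadraticExtension (ι (+ 3)) (ι (+ 3))
open PolynomialRecurrence ℚ[ω]
open LucasPowers (+ 3) (+ 3)
open import Algebra.Properties.Semiring.Exp (CommutativeRing.semiring ℚ[ω]) using (_^_)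

c z z′ : Qω
c = ⟨ 0ℚ , minusQuarter ⟩
z′ = ⟨ - 1ℚ , 1ℚ ⟩
z = ⟨ ι (+ 2) , - 1ℚ ⟩

z′²[1+4c]≡1 : z′ ⊛ (z′ ⊛ (1ω ⊕ ⟦ 4 ⟧ ⊛ c)) ≡ 1ω
z′²[1+4c]≡1 = refl

z′[1+2c]≡½ : z′ ⊛ (1ω ⊕ ⟦ 2 ⟧ ⊛ c) ≡ scalar ½
z′[1+2c]≡½ = refl

zz′≡1 : z ⊛ z′ ≡ 1ω
zz′≡1 = refl

z³≡-1 : z ⊛ (z ⊛ z) ≡ scalar (- 1ℚ)
z³≡-1 = refl

⟦⟧-scalar : ∀ n → ⟦ n ⟧ ≡ scalar (ι (+ n))
⟦⟧-scalar zero    = refl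
⟦⟧-scalar (suc n) = trans (cong (1ω ⊕_) (⟦⟧-scalar n)) (pair (sym (ι-+ (+ 1) (+ n))) refl)

ω-part-⟦⟧ : ∀ n x → ω-part (⟦ n ⟧ ⊛ x) ≡ ι (+ n) * ω-part x
ω-part-⟦⟧ n x = trans (cong (λ s → ω-part (s ⊛ x)) (⟦⟧-scalar n)) (ω-part-scalar (ι (+ n)) x)

w : ℕ → ℚ
w n = ω-part (z′ ^ n ⊛ P n c)

w-recurrence : ∀ m →
  ι (+ (2 ℕ.+ m)) * w (2 ℕ.+ m) + ι (+ (1 ℕ.+ m)) * w m ≡ ι (+ (3 ℕ.+ 2 ℕ.* m)) * (½ * w (1 ℕ.+ m))
w-recurrence m = begin
  ι (+ (2 ℕ.+ m)) * w (2 ℕ.+ m) + ι (+ (1 ℕ.+ m)) * w m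
    ≡⟨ cong₂ _+_ (ω-part-⟦⟧ (2 ℕ.+ m) W₂) (ω-part-⟦⟧ (1 ℕ.+ m) W₀) ⟨
  ω-part (⟦ 2 ℕ.+ m ⟧ ⊛ W₂) + ω-part (⟦ 1 ℕ.+ m ⟧ ⊛ W₀)
    ≡⟨ ω-part-⊕ (⟦ 2 ℕ.+ m ⟧ ⊛ W₂) (⟦ 1 ℕ.+ m ⟧ ⊛ W₀) ⟨
  ω-part (⟦ 2 ℕ.+ m ⟧ ⊛ W₂ ⊕ ⟦ 1 ℕ.+ m ⟧ ⊛ W₀)
    ≡⟨ cong ω-part (twisted-recurrence z′²[1+4c]≡1 z′[1+2c]≡½ m) ⟩
  ω-part (⟦ 3 ℕ.+ 2 ℕ.* m ⟧ ⊛ (scalar ½ ⊛ W₁))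
    ≡⟨ ω-part-⟦⟧ (3 ℕ.+ 2 ℕ.* m) (scalar ½ ⊛ W₁) ⟩
  ι (+ (3 ℕ.+ 2 ℕ.* m)) * ω-part (scalar ½ ⊛ W₁)
    ≡⟨ cong (ι (+ (3 ℕ.+ 2 ℕ.* m)) *_) (ω-part-scalar ½ W₁) ⟩
  ι (+ (3 ℕ.+ 2 ℕ.* m)) * (½ * w (1 ℕ.+ m)) ∎
  where
  open ≡-Reasoning
  W₀ = z′ ^ m ⊛ P m c
  W₁ = z′ ^ (1 ℕ.+ m) ⊛ P (1 ℕ.+ m) c
  W₂ = z′ ^ (2 ℕ.+ m) ⊛ P (2 ℕ.+ m) c

-- Every W_n is rational: w_0 = w_1 = 0 by computation, and the recurrence propagates
-- vanishing since its leading coefficient m + 2 is nonzero.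
w-vanishes : ∀ n → w n ≡ 0ℚ × w (suc n) ≡ 0ℚ
w-vanishes zero    = refl , refl
w-vanishes (suc m) with w-vanishes m
... | w₀≡0 , w₁≡0 = w₁≡0 , cancel-nonzero (ι (+ (2 ℕ.+ m))) (w (2 ℕ.+ m)) 2+m≢0 leading-term≡0
  where
  open ≡-Reasoning
  2+m≢0 : ι (+ (2 ℕ.+ m)) ≢ 0ℚ
  2+m≢0 eq with ι-injective {+ (2 ℕ.+ m)} {+ 0} eq
  ... | ()
  leading-term≡0 : ι (+ (2 ℕ.+ m)) * w (2 ℕ.+ m) ≡ 0ℚ
  leading-term≡0 = begin
    ι₂ * w (2 ℕ.+ m)                     ≡⟨ ℚₚ.+-identityʳ (ι₂ * w (2 ℕ.+ m)) ⟨
    ι₂ * w (2 ℕ.+ m) + 0ℚ                ≡⟨ cong (_+_ (ι₂ * w (2 ℕ.+ m))) (ℚₚ.*-zeroʳ ι₁) ⟨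
    ι₂ * w (2 ℕ.+ m) + ι₁ * 0ℚ           ≡⟨ cong (λ t → ι₂ * w (2 ℕ.+ m) + ι₁ * t) w₀≡0 ⟨
    ι₂ * w (2 ℕ.+ m) + ι₁ * w m          ≡⟨ w-recurrence m ⟩
    ι₃ * (½ * w (1 ℕ.+ m))               ≡⟨ cong (λ t → ι₃ * (½ * t)) w₁≡0 ⟩
    ι₃ * (½ * 0ℚ)                        ≡⟨ cong (ι₃ *_) (ℚₚ.*-zeroʳ ½) ⟩
    ι₃ * 0ℚ                              ≡⟨ ℚₚ.*-zeroʳ ι₃ ⟩
    0ℚ                                   ∎
    where
    ι₁ = ι (+ (1 ℕ.+ m))
    ι₂ = ι (+ (2 ℕ.+ m))
    ι₃ = ι (+ (3 ℕ.+ 2 ℕ.* m))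

z-power-scalar : ∀ q → ∃ λ r → z ^ (q ℕ.* 3) ≡ scalar r
z-power-scalar zero    = 1ℚ , refl
z-power-scalar (suc q) with z-power-scalar q
... | r , z^3q≡r = - 1ℚ * r , (begin
  z ⊛ (z ⊛ (z ⊛ z ^ (q ℕ.* 3))) ≡⟨ cong (z ⊛_) (⊛-assoc z z _) ⟨
  z ⊛ (z ⊛ z ⊛ z ^ (q ℕ.* 3))   ≡⟨ ⊛-assoc z (z ⊛ z) _ ⟨
  z ⊛ (z ⊛ z) ⊛ z ^ (q ℕ.* 3)   ≡⟨ cong₂ _⊛_ z³≡-1 z^3q≡r ⟩
  scalar (- 1ℚ) ⊛ scalar r       ≡⟨ scalar-⊛ (- 1ℚ) r ⟩
  scalar (- 1ℚ * r)              ∎)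
  where open ≡-Reasoning

sumTo-cong : ∀ d {f g : ℕ → ℚ} → (∀ k → f k ≡ g k) → sumTo d f ≡ sumTo d g
sumTo-cong zero    f≡g = f≡g 0
sumTo-cong (suc d) f≡g = cong₂ _+_ (sumTo-cong d f≡g) (f≡g (suc d))

ω-part-sum : ∀ d f → ω-part (sum d f) ≡ sumTo d (λ k → ω-part (f k))
ω-part-sum zero    f = refl
ω-part-sum (suc d) f = trans (ω-part-⊕ (sum d f) (f (suc d))) (cong (_+ ω-part (f (suc d))) (ω-part-sum d f))

-- The k-th summand of the theorem is the ω-coordinate of the k-th term of P_n(c),
-- because the ω-coordinate of (−ω/4)^k is u_k(3,3)·(−1/4)^k.
summand-as-ω-part : ∀ n k → ω-part (⟦ coeff n k ⟧ ⊛ c ^ k) ≡ term n k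
summand-as-ω-part n k = begin
  ω-part (⟦ coeff n k ⟧ ⊛ c ^ k)              ≡⟨ ω-part-⟦⟧ (coeff n k) (c ^ k) ⟩
  ι (+ coeff n k) * ω-part (c ^ k)            ≡⟨ cong (ι (+ coeff n k) *_) (ω-part-power minusQuarter k) ⟩
  ι (+ coeff n k) * (ι (u k) * minusQuarter ^ℚ k) ≡⟨ ℚₚ.*-assoc (ι (+ coeff n k)) (ι (u k)) _ ⟨
  ι (+ coeff n k) * ι (u k) * minusQuarter ^ℚ k   ≡⟨ cong (_* minusQuarter ^ℚ k) (ι-* (+ coeff n k) (u k)) ⟨
  term n k                                    ∎
  where open ≡-Reasoning

sum-as-ω-part : ∀ n → sumTo n (term n) ≡ ω-part (P n c)
sum-as-ω-part n = sym (trans (ω-part-sum n _) (sumTo-cong n (summand-as-ω-part n)))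

theorem1p6 : (n : ℕ) → 3 ∣ n → sumTo n (term n) ≡ 0ℚ
theorem1p6 _ (divides q refl) = begin
  sumTo N (term N)                        ≡⟨ sum-as-ω-part N ⟩
  ω-part (P N c)                          ≡⟨ cong ω-part (inverse-powers zz′≡1 N (P N c)) ⟨
  ω-part (z ^ N ⊛ (z′ ^ N ⊛ P N c))       ≡⟨ cong (λ s → ω-part (s ⊛ (z′ ^ N ⊛ P N c))) z^N≡r ⟩
  ω-part (scalar r ⊛ (z′ ^ N ⊛ P N c))    ≡⟨ ω-part-scalar r (z′ ^ N ⊛ P N c) ⟩
  r * w N                                 ≡⟨ cong (r *_) (proj₁ (w-vanishes N)) ⟩
  r * 0ℚ                                  ≡⟨ ℚₚ.*-zeroʳ r ⟩
  0ℚ                                      ∎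
  where
  open ≡-Reasoning
  N = q ℕ.* 3
  r = proj₁ (z-power-scalar q)
  z^N≡r = proj₂ (z-power-scalar q)
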